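{- Let $a\geqslant 2$, $b\geqslant 0$ be integers, let $\pi\in\mathfrak{S}_n$, and let $\pi_{i_1}\pi_{i_2}\ldots\pi_{i_m}$ (with $i_1<\dots<i_m$) be a subsequence of $\pi$. If $\pi_{i_1}\pi_{i_2}\ldots\pi_{i_m}$ is not order-isomorphic to $S(\pi)_{i_1}S(\pi)_{i_2}\ldots S(\pi)_{i_m}$, then this subsequence contains the entry of value $\underline{a}$ and at least one $a-1$ element associated with $\underline{a}$.
   Context: Permutations are written in one-line notation $\pi=\pi_1\ldots\pi_n$; $\mathfrak{S}_n$ is the set of permutations of size $n$. Two sequences of equal length are order-isomorphic if their entries are in the same relative order. A permutation $\pi$ contains a pattern $\rho$ of size $k$ if some subsequence $\pi_{i_1}\ldots\pi_{i_k}$ ($i_1<\dots<i_k$) is order-isomorphic to $\rho$ (an occurrence); in it, $\pi_{i_j}$ plays the role of the value $\rho_j$. $\pi$ avoids $\rho$ if it does not contain it. $[x,y]$ is the set of integers between $x$ and $y$ inclusive; $\iota_k=12\ldots k$. For integers $c\geqslant1,d\geqslant0$ with $c+d\geqslant 2$, the partial shuffle $\Pi(c,d)$ is the set of permutations of size $c+d$ obtained by writing $[c+d]\setminus\{c\}$ in increasing order and inserting $c$ in every position except the one giving $\iota_{c+d}$. Fix $a\geqslant 2$, $b\geqslant 0$. If $\pi$ contains a pattern from $\Pi(a-1,b+1)$, $\underline{a}$ is the smallest value of an entry of $\pi$ playing the role of $a$ in some occurrence of a pattern from $\Pi(a-1,b+1)$; an entry is an $a-1$ element associated with $\underline{a}$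 if it plays the role of $a-1$ in an occurrence of a pattern from $\Pi(a-1,b+1)$ in which the entry of value $\underline{a}$ plays the role of $a$; $\underline{a-1}$ is the smallest value of such an entry. The map $S:\mathfrak{S}_n\to\mathfrak{S}_n$ (depending on $a,b$) is defined by: $S(\pi)=\pi$ if $\pi$ avoids every pattern of $\Pi(a-1,b+1)$; otherwise $S(\pi)_i=\pi_i+1$ if $\pi_i\in[\underline{a-1},\underline{a}-1]$, $S(\pi)_i=\underline{a-1}$ if $\pi_i=\underline{a}$, and $S(\pi)_i=\pi_i$ otherwise. -}

module Defs where

open import Data.Nat using (ℕ; zero; suc; _+_; _∸_; _≤_; _<_; _≤ᵇ_; _<ᵇ_; _≡ᵇ_)
open import Data.Bool using (if_then_else_; _∧_)
open import Data.Fin using (Fin)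
import Data.Fin as F
open import Data.List using (List; _∷_; []; _++_; map; upTo; take; drop; length; lookup)
open import Data.Product using (Σ; ∃; _×_; _,_)
open import Relation.Binary.PropositionalEquality using (_≡_; _≢_)

IsPerm : (n : ℕ) → (Fin n → ℕ) → Set
IsPerm n π = (∀ i → 1 ≤ π i × π i ≤ n) × (∀ i j → π i ≡ π j → i ≡ j)

StrictInc : ∀ {m n} → (Fin m → Fin n) → Set
StrictInc {m} ι = ∀ (j k : Fin m) → j F.< k → ι j F.< ι k

OrderIso : ∀ {m} → (Fin m → ℕ) → (Fin m → ℕ) → Set
OrderIso {m} u v = ∀ (j k : Fin m) → (u j < u k → v j < v k) × (v j < v k → u j < u k)

Occ : ∀ {n} → (Fin n → ℕ) → (ρ : List ℕ) → (Fin (length ρ) → Fin n) → Set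
Occ π ρ ι = StrictInc ι × OrderIso (λ j → π (ι j)) (lookup ρ)

-- [c+d] \ {c} written in increasing order: 1..c-1, c+1..c+d
baseList : ℕ → ℕ → List ℕ
baseList c d = map suc (upTo (c ∸ 1)) ++ map (λ i → c + suc i) (upTo d)

insertC : ℕ → ℕ → ℕ → List ℕ
insertC c d p = take p (baseList c d) ++ (c ∷ drop p (baseList c d))

-- membership in the partial shuffle Π(c,d): all insertion positions
-- p ∈ [0, c+d-1] except p = c-1 (which gives the identity)
InPi : ℕ → ℕ → List ℕ → Set
InPi c d ρ = Σ ℕ λ p → p < c + d × p ≢ c ∸ 1 × ρ ≡ insertC c d p

PlaysA : ℕ → ℕ → ∀ {n} → (Fin n → ℕ) → Fin n → Set
PlaysA a b {n} π e =
  Σ (List ℕ) λ ρ → InPi (a ∸ 1) (suc b) ρ ×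
  Σ (Fin (length ρ) → Fin n) λ ι → Occ π ρ ι ×
  Σ (Fin (length ρ)) λ j → ι j ≡ e × lookup ρ j ≡ a

IsUnderA : ℕ → ℕ → ∀ {n} → (Fin n → ℕ) → ℕ → Set
IsUnderA a b {n} π ua =
  (Σ (Fin n) λ e → PlaysA a b π e × π e ≡ ua) × (∀ e → PlaysA a b π e → ua ≤ π e)

AssocA1 : ℕ → ℕ → ∀ {n} → (Fin n → ℕ) → ℕ → Fin n → Set
AssocA1 a b {n} π ua e =
  Σ (List ℕ) λ ρ → InPi (a ∸ 1) (suc b) ρ ×
  Σ (Fin (length ρ) → Fin n) λ ι → Occ π ρ ι ×
  (Σ (Fin (length ρ)) λ j → π (ι j) ≡ ua × lookup ρ j ≡ a) ×
  (Σ (Fin (length ρ)) λ j → ι j ≡ e × lookup ρ j ≡ a ∸ 1)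

IsUnderA1 : ℕ → ℕ → ∀ {n} → (Fin n → ℕ) → ℕ → ℕ → Set
IsUnderA1 a b {n} π ua ua1 =
  (Σ (Fin n) λ e → AssocA1 a b π ua e × π e ≡ ua1) × (∀ e → AssocA1 a b π ua e → ua1 ≤ π e)

-- the map S in the case where π contains a pattern of Π(a-1,b+1),
-- given ua = a-underline and ua1 = (a-1)-underline
Smap : ∀ {n} → ℕ → ℕ → (Fin n → ℕ) → (Fin n → ℕ)
Smap ua ua1 π i =
  if (ua1 ≤ᵇ π i) ∧ (π i <ᵇ ua) then suc (π i)
  else (if π i ≡ᵇ ua then ua1 else π i)

module Submission where

-- Off the value ua, S only raises [ua1, ua) by one, and off [ua1, ua) it only lowers
-- ua to ua1, past no other value; on either set S is increasing. So a subsequence whose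
-- relative order S changes contains ua and an entry y with ua1 ≤ π y < ua. Every such y
-- is an a-1 element associated with ua: in an occurrence witnessing ua1, let y play a-1
-- instead of the entry playing it there. Among the other entries y is then inserted at
-- some position q, and the new pattern lies in Π(a-1, b+1) unless q is the position that
-- yields the identity, i.e. y sits right before the entry playing a. In that case let y
-- play a instead: this gives an occurrence in which y plays a although π y < ua,
-- contradicting the minimality of ua.

open import Defs
open import Data.Bool using (true; false; if_then_else_; _∧_)
open import Data.Empty using (⊥-elim)
open import Data.Fin using (Fin; toℕ; fromℕ<)
open import Data.Fin.Properties using (toℕ-fromℕ<; toℕ<n; toℕ-injective; any?)
open import Data.List using (List; _∷_; []; _++_; map; upTo; applyUpTo; take; drop; length; lookup)
open import Data.List.Properties using (length-++; length-map; length-upTo; map-upTo)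
open import Data.Nat using (ℕ; zero; suc; _+_; _≤_; _<_; z≤n; s≤s; z<s; s≤s⁻¹; _≤ᵇ_; _<ᵇ_; _≡ᵇ_)
open import Data.Nat.Properties
open import Data.Product using (Σ; _×_; _,_; proj₁; proj₂)
open import Data.Sum using (inj₁; inj₂)
open import Data.Unit using (⊤; tt)
open import Function using (_∘_)
open import Relation.Nullary using (¬_; yes; no)
open import Relation.Nullary.Decidable using (_×-dec_)
open import Relation.Nullary.Reflects using (ofʸ; ofⁿ; fromEquivalence)
open import Relation.Binary.PropositionalEquality using (_≡_; _≢_; refl; sym; trans; cong; cong₂; subst; subst₂)
open import Relation.Binary.Definitions using (tri<; tri≈; tri>)

-- The c + d entries of an occurrence of a pattern of Π(c, d): base u plays the
-- (u+1)-st smallest element of [c+d] ∖ {c}, and ins plays c.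
data Role : Set where
  base : ℕ → Role
  ins  : Role

label : {A : Set} → (ℕ → A) → A → Role → A
label f w (base u) = f u
label f w ins      = w

label-map : {A B : Set} (h : A → B) (f : ℕ → A) (w : A) →
  ∀ r → h (label f w r) ≡ label (h ∘ f) (h w) r
label-map h f w (base u) = refl
label-map h f w ins      = refl

Valid : ℕ → Role → Set
Valid L (base u) = u < L
Valid L ins      = ⊤

Increasing : ℕ → (ℕ → ℕ) → Set
Increasing L f = ∀ {u v} → v < L → u < v → f u < f v

record InsertedAt (L q : ℕ) (f : ℕ → ℕ) (w : ℕ) : Set where
  field
    increasing : Increasing L f
    below      : ∀ {u} → u < L → u < q → f u < w
    above      : ∀ {u} → u < L → q ≤ u → w < f u

open InsertedAt

insertedAt-transfer : ∀ {L q f w g z} → InsertedAt L q f w → InsertedAt L q g z →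
  ∀ {r s} → Valid L r → Valid L s → label f w r < label f w s → label g z r < label g z s
insertedAt-transfer F G {base u} {base v} u<L v<L lt with <-cmp u v
... | tri< u<v _ _ = increasing G v<L u<v
... | tri≈ _ refl _ = ⊥-elim (<-irrefl refl lt)
... | tri> _ _ v<u = ⊥-elim (<-asym lt (increasing F u<L v<u))
insertedAt-transfer {q = q} F G {base u} {ins} u<L _ lt with u <? q
... | yes u<q = below G u<L u<q
... | no u≮q = ⊥-elim (<-asym lt (above F u<L (≮⇒≥ u≮q)))
insertedAt-transfer {q = q} F G {ins} {base u} _ u<L lt with u <? q
... | yes u<q = ⊥-elim (<-asym lt (below F u<L u<q))
... | no u≮q = above G u<L (≮⇒≥ u≮q)
insertedAt-transfer F G {ins} {ins} _ _ lt = ⊥-elim (<-irrefl refl lt)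

insertedAt-orderIso : ∀ {L q f w g z m} → InsertedAt L q f w → InsertedAt L q g z →
  (σ : Fin m → Role) → (∀ k → Valid L (σ k)) → OrderIso (label f w ∘ σ) (label g z ∘ σ)
insertedAt-orderIso F G σ σ-valid j k =
  insertedAt-transfer F G (σ-valid j) (σ-valid k) , insertedAt-transfer G F (σ-valid j) (σ-valid k)

insertedAt-from : ∀ {L q f w g z} → InsertedAt L q f w →
  (∀ {r s} → Valid L r → Valid L s → label f w r < label f w s → label g z r < label g z s) →
  InsertedAt L q g z
insertedAt-from F h = record
  { increasing = λ v<L u<v → h {base _} {base _} (<-trans u<v v<L) v<L (increasing F v<L u<v)
  ; below      = λ u<L u<q → h {base _} {ins} u<L tt (below F u<L u<q)
  ; above      = λ u<L q≤u → h {ins} {base _} tt u<L (above F u<L q≤u)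
  }

insertedAt-≢ : ∀ {L q f w k} → InsertedAt L q f w → k < L → f k ≢ w
insertedAt-≢ {q = q} {k = k} F k<L fk≡w with k <? q
... | yes k<q = <-irrefl fk≡w (below F k<L k<q)
... | no k≮q = <-irrefl (sym fk≡w) (above F k<L (≮⇒≥ k≮q))

insertedAt-between : ∀ {L c f w z} → c < L → w < z → z < f c →
  InsertedAt L c f w → InsertedAt L c f z
insertedAt-between {L} {c} {f} {w} {z} c<L w<z z<fc F = record
  { increasing = increasing F
  ; below      = λ u<L u<c → <-trans (below F u<L u<c) w<z
  ; above      = above′
  }
  where
  above′ : ∀ {u} → u < L → c ≤ u → z < f u
  above′ u<L c≤u with m≤n⇒m<n∨m≡n c≤u
  ... | inj₁ c<u = <-trans z<fc (increasing F u<L c<u)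
  ... | inj₂ refl = z<fc

insertedAt-compare : ∀ {L q c f w z} → c < L → q ≢ c →
  InsertedAt L q f w → InsertedAt L c f z → (c < q → z < w) × (q ≤ c → w < z)
insertedAt-compare {L} {q} {c} {f} {w} {z} c<L q≢c F Z = z<w , w<z
  where
  z<w : c < q → z < w
  z<w c<q = <-trans (above Z c<L ≤-refl) (below F c<L c<q)
  w<z : q ≤ c → w < z
  w<z q≤c with ≤∧≢⇒< q≤c q≢c
  ... | s≤s {n = c′} q≤c′ = <-trans (above F c′<L q≤c′) (below Z c′<L (n<1+n c′))
    where
    c′<L : c′ < L
    c′<L = <-trans (n<1+n c′) c<L

insertedAt-replace : ∀ {L q c f w z} → InsertedAt L q f w → InsertedAt L c f z →
  (c < q → z < w) → (q ≤ c → w < z) →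
  ∀ {g} → g c ≡ z → (∀ {u} → u ≢ c → g u ≡ f u) → InsertedAt L q g w
insertedAt-replace {L} {q} {c} {f} {w} {z} F Z z<w w<z {g} g-c g-other = record
  { increasing = increasing′ ; below = below′ ; above = above′ }
  where
  increasing′ : Increasing L g
  increasing′ {u} {v} v<L u<v with u ≟ c | v ≟ c
  ... | yes refl | yes refl = ⊥-elim (<-irrefl refl u<v)
  ... | yes refl | no v≢c rewrite g-c | g-other v≢c = above Z v<L (<⇒≤ u<v)
  ... | no u≢c | yes refl rewrite g-c | g-other u≢c = below Z (<-trans u<v v<L) u<v
  ... | no u≢c | no v≢c rewrite g-other u≢c | g-other v≢c = increasing F v<L u<v
  below′ : ∀ {u} → u < L → u < q → g u < w
  below′ {u} u<L u<q with u ≟ c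
  ... | yes refl rewrite g-c = z<w u<q
  ... | no u≢c rewrite g-other u≢c = below F u<L u<q
  above′ : ∀ {u} → u < L → q ≤ u → w < g u
  above′ {u} u<L q≤u with u ≟ c
  ... | yes refl rewrite g-c = w<z q≤u
  ... | no u≢c rewrite g-other u≢c = above F u<L q≤u

insertion-point : ∀ {L f w} → Increasing L f → (∀ {k} → k < L → f k ≢ w) →
  Σ ℕ λ q → q ≤ L × InsertedAt L q f w
insertion-point {zero} inc _ = 0 , z≤n , record { increasing = inc ; below = λ () ; above = λ () }
insertion-point {suc L} {f} {w} inc f≢w with <-cmp (f L) w
... | tri< fL<w _ _ = suc L , ≤-refl , record
  { increasing = inc
  ; below      = λ u<sL _ → below-L u<sL
  ; above      = λ u<sL sL≤u → ⊥-elim (<⇒≱ u<sL sL≤u)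
  }
  where
  below-L : ∀ {u} → u < suc L → f u < w
  below-L (s≤s u≤L) with m≤n⇒m<n∨m≡n u≤L
  ... | inj₁ u<L = <-trans (inc (n<1+n L) u<L) fL<w
  ... | inj₂ refl = fL<w
... | tri≈ _ fL≡w _ = ⊥-elim (f≢w (n<1+n L) fL≡w)
... | tri> _ _ w<fL with insertion-point {L} (λ v<L → inc (m<n⇒m<1+n v<L)) (λ k<L → f≢w (m<n⇒m<1+n k<L))
...   | q , q≤L , I = q , m≤n⇒m≤1+n q≤L , record
  { increasing = inc ; below = λ u<sL u<q → below I (<-≤-trans u<q q≤L) u<q ; above = above-q }
  where
  above-q : ∀ {u} → u < suc L → q ≤ u → w < f u
  above-q (s≤s u≤L) q≤u with m≤n⇒m<n∨m≡n u≤L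
  ... | inj₁ u<L = above I u<L q≤u
  ... | inj₂ refl = w<fL

skip : ℕ → ℕ → ℕ
skip zero    u       = suc u
skip (suc q) zero    = zero
skip (suc q) (suc u) = suc (skip q u)

slot : ℕ → Role → ℕ
slot q = label (skip q) q

skip-insertedAt : ∀ {L} q → InsertedAt L q (skip q) q
skip-insertedAt q = record
  { increasing = λ _ → skip-increasing q ; below = λ _ → skip-below q ; above = λ _ → skip-above q }
  where
  skip-increasing : ∀ q {u v} → u < v → skip q u < skip q v
  skip-increasing zero    u<v             = s≤s u<v
  skip-increasing (suc q) {zero} {suc v} _ = z<s
  skip-increasing (suc q) {suc u} {suc v} (s≤s u<v) = s≤s (skip-increasing q u<v)
  skip-below : ∀ q {u} → u < q → skip q u < q
  skip-below (suc q) {zero}  _         = z<s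
  skip-below (suc q) {suc u} (s≤s u<q) = s≤s (skip-below q u<q)
  skip-above : ∀ q {u} → q ≤ u → q < skip q u
  skip-above zero    _         = z<s
  skip-above (suc q) (s≤s q≤u) = s≤s (skip-above q q≤u)

skip-self : ∀ q → skip q q ≡ suc q
skip-self zero    = refl
skip-self (suc q) = cong suc (skip-self q)

slot-bound : ∀ {L} q r → q ≤ L → Valid L r → slot q r ≤ L
slot-bound zero    (base u)       _         u<L       = u<L
slot-bound (suc q) (base zero)    _         _         = z≤n
slot-bound (suc q) (base (suc u)) (s≤s q≤L) (s≤s u<L) = s≤s (slot-bound q (base u) q≤L u<L)
slot-bound q       ins            q≤L       _         = q≤L

sucRole : Role → Role
sucRole (base u) = base (suc u)
sucRole ins      = ins

roleAt : ℕ → ℕ → Role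
roleAt zero    zero    = ins
roleAt zero    (suc t) = base t
roleAt (suc q) zero    = base zero
roleAt (suc q) (suc t) = sucRole (roleAt q t)

slot-roleAt : ∀ q t → slot q (roleAt q t) ≡ t
slot-roleAt zero    zero    = refl
slot-roleAt zero    (suc t) = refl
slot-roleAt (suc q) zero    = refl
slot-roleAt (suc q) (suc t) = trans (slot-sucRole (roleAt q t)) (cong suc (slot-roleAt q t))
  where
  slot-sucRole : ∀ r → slot (suc q) (sucRole r) ≡ suc (slot q r)
  slot-sucRole (base u) = refl
  slot-sucRole ins      = refl

roleAt-slot : ∀ q r → roleAt q (slot q r) ≡ r
roleAt-slot zero    (base u)       = refl
roleAt-slot zero    ins            = refl
roleAt-slot (suc q) (base zero)    = refl
roleAt-slot (suc q) (base (suc u)) = cong sucRole (roleAt-slot q (base u))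
roleAt-slot (suc q) ins            = cong sucRole (roleAt-slot q ins)

roleAt-valid : ∀ {L} q t → q ≤ L → t ≤ L → Valid L (roleAt q t)
roleAt-valid zero    zero    _         _         = tt
roleAt-valid zero    (suc t) _         t<L       = t<L
roleAt-valid (suc q) zero    (s≤s _)   _         = z<s
roleAt-valid (suc q) (suc t) (s≤s q≤L) (s≤s t≤L) =
  sucRole-valid (roleAt q t) (roleAt-valid q t q≤L t≤L)
  where
  sucRole-valid : ∀ {L} r → Valid L r → Valid (suc L) (sucRole r)
  sucRole-valid (base u) u<L = s≤s u<L
  sucRole-valid ins      _   = tt

nth : List ℕ → ℕ → ℕ
nth []       _       = 0
nth (x ∷ xs) zero    = x
nth (x ∷ xs) (suc t) = nth xs t

lookup≡nth : ∀ xs (k : Fin (length xs)) → lookup xs k ≡ nth xs (toℕ k)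
lookup≡nth (x ∷ xs) Fin.zero    = refl
lookup≡nth (x ∷ xs) (Fin.suc k) = lookup≡nth xs k

nth-applyUpTo : ∀ f n {t} → t < n → nth (applyUpTo f n) t ≡ f t
nth-applyUpTo f (suc n) {zero}  _         = refl
nth-applyUpTo f (suc n) {suc t} (s≤s t<n) = nth-applyUpTo (f ∘ suc) n t<n

length-insertion : ∀ p (x : ℕ) xs → p ≤ length xs →
  length (take p xs ++ x ∷ drop p xs) ≡ suc (length xs)
length-insertion zero    x xs       _         = refl
length-insertion (suc p) x (y ∷ xs) (s≤s p≤n) = cong suc (length-insertion p x xs p≤n)

nth-insertion : ∀ p (x : ℕ) xs r → p ≤ length xs →
  nth (take p xs ++ x ∷ drop p xs) (slot p r) ≡ label (nth xs) x r
nth-insertion zero    x xs       (base u)       _         = refl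
nth-insertion zero    x xs       ins            _         = refl
nth-insertion (suc p) x (y ∷ xs) (base zero)    _         = refl
nth-insertion (suc p) x (y ∷ xs) (base (suc u)) (s≤s p≤n) = nth-insertion p x xs (base u) p≤n
nth-insertion (suc p) x (y ∷ xs) ins            (s≤s p≤n) = nth-insertion p x xs ins p≤n

length-baseList : ∀ c0 d → length (baseList (suc c0) d) ≡ c0 + d
length-baseList c0 d = trans (length-++ (map suc (upTo c0)))
  (cong₂ _+_ (trans (length-map suc (upTo c0)) (length-upTo c0))
             (trans (length-map _ (upTo d)) (length-upTo d)))

nth-baseList : ∀ c0 d {u} → u < c0 + d → nth (baseList (suc c0) d) u ≡ suc (skip c0 u)
nth-baseList c0 d u<L
  rewrite map-upTo suc c0 | map-upTo (λ i → suc c0 + suc i) d =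
  nth-split suc c0 (λ i → cong suc (+-suc c0 i)) u<L
  where
  nth-split : ∀ (f : ℕ → ℕ) c {g : ℕ → ℕ} → (∀ i → g i ≡ f (suc (c + i))) →
    ∀ {u} → u < c + d → nth (applyUpTo f c ++ applyUpTo g d) u ≡ f (skip c u)
  nth-split f zero    g≡ u<d = trans (nth-applyUpTo _ d u<d) (g≡ _)
  nth-split f (suc c) g≡ {zero}  _         = refl
  nth-split f (suc c) g≡ {suc u} (s≤s u<L) = nth-split (f ∘ suc) c g≡ u<L

patternValue : ℕ → Role → ℕ
patternValue c0 = label (suc ∘ skip c0) (suc c0)

patternValue-insertedAt : ∀ {L} c0 → InsertedAt L c0 (suc ∘ skip c0) (suc c0)
patternValue-insertedAt {L} c0 = record
  { increasing = λ v<L u<v → s≤s (increasing S v<L u<v)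
  ; below      = λ u<L u<c → s≤s (below S u<L u<c)
  ; above      = λ u<L c≤u → s≤s (above S u<L c≤u)
  }
  where
  S : InsertedAt L c0 (skip c0) c0
  S = skip-insertedAt c0

length-insertC : ∀ c0 d p → p ≤ c0 + d → length (insertC (suc c0) d p) ≡ suc (c0 + d)
length-insertC c0 d p p≤L =
  trans (length-insertion p (suc c0) _ (subst (p ≤_) (sym (length-baseList c0 d)) p≤L))
        (cong suc (length-baseList c0 d))

nth-insertC : ∀ c0 d p r → p ≤ c0 + d → Valid (c0 + d) r →
  nth (insertC (suc c0) d p) (slot p r) ≡ patternValue c0 r
nth-insertC c0 d p (base u) p≤L u<L = trans (nth-insertion p (suc c0) _ (base u) p≤B) (nth-baseList c0 d u<L)
  where
  p≤B : p ≤ length (baseList (suc c0) d)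
  p≤B = subst (p ≤_) (sym (length-baseList c0 d)) p≤L
nth-insertC c0 d p ins p≤L _ = nth-insertion p (suc c0) _ ins (subst (p ≤_) (sym (length-baseList c0 d)) p≤L)

replace : {A : Set} → (ℕ → A) → ℕ → A → ℕ → A
replace f c z u with u ≟ c
... | yes _ = z
... | no _  = f u

replace-same : {A : Set} (f : ℕ → A) → ∀ c z → replace f c z c ≡ z
replace-same f c z with c ≟ c
... | yes _   = refl
... | no c≢c = ⊥-elim (c≢c refl)

replace-other : {A : Set} (f : ℕ → A) → ∀ c z {u} → u ≢ c → replace f c z u ≡ f u
replace-other f c z {u} u≢c with u ≟ c
... | yes u≡c = ⊥-elim (u≢c u≡c)
... | no _    = refl

orderIso-resp : ∀ {m} {u u′ v v′ : Fin m → ℕ} → (∀ k → u k ≡ u′ k) → (∀ k → v k ≡ v′ k) →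
  OrderIso u v → OrderIso u′ v′
orderIso-resp u≡ v≡ iso j k =
  (λ lt → subst₂ _<_ (v≡ j) (v≡ k) (proj₁ (iso j k) (subst₂ _<_ (sym (u≡ j)) (sym (u≡ k)) lt))) ,
  (λ lt → subst₂ _<_ (u≡ j) (u≡ k) (proj₂ (iso j k) (subst₂ _<_ (sym (v≡ j)) (sym (v≡ k)) lt)))

orderIso-≡ : ∀ {m} (u v : Fin m → ℕ) → OrderIso u v → ∀ j k → v j ≡ v k → u j ≡ u k
orderIso-≡ u v iso j k vj≡vk with <-cmp (u j) (u k)
... | tri< lt _ _ = ⊥-elim (<-irrefl vj≡vk (proj₁ (iso j k) lt))
... | tri≈ _ eq _ = eq
... | tri> _ _ gt = ⊥-elim (<-irrefl (sym vj≡vk) (proj₁ (iso k j) gt))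

-- An occurrence in π of insertC (c0+1) (b+1) p ∈ Π(c0+1, b+1), where c0 = a-2:
-- β u plays base u and x plays ins, so x plays a-1 and β c0 plays a.
record PiOccurrence {n} (π : Fin n → ℕ) (c0 b : ℕ) : Set where
  field
    p         : ℕ
    p≤        : p ≤ c0 + suc b
    p≢c0      : p ≢ c0
    β         : ℕ → Fin n
    x         : Fin n
    positions : InsertedAt (c0 + suc b) p (toℕ ∘ β) (toℕ x)
    values    : InsertedAt (c0 + suc b) c0 (π ∘ β) (π x)

module _ {n} {π : Fin n → ℕ} {c0 b} (O : PiOccurrence π c0 b) where
  open PiOccurrence O

  private
    L : ℕ
    L = c0 + suc b
    ρ : List ℕ
    ρ = insertC (suc c0) (suc b) p

    length-ρ : length ρ ≡ suc L
    length-ρ = length-insertC c0 (suc b) p p≤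

    role : Fin (length ρ) → Role
    role k = roleAt p (toℕ k)

    ι : Fin (length ρ) → Fin n
    ι k = label β x (role k)

    role-valid : ∀ k → Valid L (role k)
    role-valid k = roleAt-valid p (toℕ k) p≤ (s≤s⁻¹ (subst (toℕ k <_) length-ρ (toℕ<n k)))

    lookup-ρ : ∀ k → lookup ρ k ≡ patternValue c0 (role k)
    lookup-ρ k = trans (lookup≡nth ρ k) (trans (cong (nth ρ) (sym (slot-roleAt p (toℕ k))))
                   (nth-insertC c0 (suc b) p (role k) p≤ (role-valid k)))

    occurrence : Occ π ρ ι
    occurrence = increasing-ι , iso
      where
      increasing-ι : StrictInc ι
      increasing-ι j k j<k =
        subst₂ _<_ (sym (label-map toℕ β x (role j))) (sym (label-map toℕ β x (role k)))
        (insertedAt-transfer (skip-insertedAt p) positions (role-valid j) (role-valid k)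
          (subst₂ _<_ (sym (slot-roleAt p (toℕ j))) (sym (slot-roleAt p (toℕ k))) j<k))
      iso : OrderIso (π ∘ ι) (lookup ρ)
      iso = orderIso-resp (λ k → sym (label-map π β x (role k))) (sym ∘ lookup-ρ)
              (insertedAt-orderIso values (patternValue-insertedAt c0) role role-valid)

    index-of-role : ∀ r → Valid L r →
      Σ (Fin (length ρ)) λ j → ι j ≡ label β x r × lookup ρ j ≡ patternValue c0 r
    index-of-role r r-valid = j , cong (label β x) role-j , trans (lookup-ρ j) (cong (patternValue c0) role-j)
      where
      slot<len : slot p r < length ρ
      slot<len = subst (slot p r <_) (sym length-ρ) (s≤s (slot-bound p r p≤ r-valid))
      j : Fin (length ρ)
      j = fromℕ< slot<len
      role-j : role j ≡ r
      role-j = trans (cong (roleAt p) (toℕ-fromℕ< slot<len)) (roleAt-slot p r)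

    c0<L : c0 < L
    c0<L = m<m+n c0 z<s

  PiOccurrence-playsA : PlaysA (suc (suc c0)) b π (β c0)
  PiOccurrence-playsA with index-of-role (base c0) c0<L
  ... | j , ιj≡ , lookup-j = ρ , (p , s≤s p≤ , p≢c0 , refl) , ι , occurrence , j , ιj≡ ,
        trans lookup-j (cong suc (skip-self c0))

  PiOccurrence-assocA1 : AssocA1 (suc (suc c0)) b π (π (β c0)) x
  PiOccurrence-assocA1 with index-of-role (base c0) c0<L | index-of-role ins tt
  ... | j , ιj≡ , lookup-j | i , ιi≡ , lookup-i = ρ , (p , s≤s p≤ , p≢c0 , refl) , ι , occurrence ,
        (j , cong π ιj≡ , trans lookup-j (cong suc (skip-self c0))) , (i , ιi≡ , lookup-i)

-- The entry at index t of an occurrence, with e as a junk value for t out of range.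
entryAt : ∀ {M n} → (Fin M → Fin n) → Fin n → ℕ → Fin n
entryAt {M} ι e t with t <? M
... | yes t<M = ι (fromℕ< t<M)
... | no _    = e

entryAt-< : ∀ {M n} (ι : Fin M → Fin n) e {t} → t < M →
  Σ (Fin M) λ k → toℕ k ≡ t × entryAt ι e t ≡ ι k
entryAt-< {M} ι e {t} t<M with t <? M
... | yes t<M′ = fromℕ< t<M′ , toℕ-fromℕ< t<M′ , refl
... | no t≮M   = ⊥-elim (t≮M t<M)

PiOccurrence-from-assocA1 : ∀ {n} {π : Fin n → ℕ} {c0 b ua e} → AssocA1 (suc (suc c0)) b π ua e →
  Σ (PiOccurrence π c0 b) λ O → π (PiOccurrence.β O c0) ≡ ua × π (PiOccurrence.x O) ≡ π e
PiOccurrence-from-assocA1 {n} {π} {c0} {b} {ua} {e}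
  (ρ , (p , s≤s p≤ , p≢c0 , refl) , ι , (ι-increasing , iso) ,
   (ja , πιja≡ua , lookup-ja) , (je , ιje≡e , lookup-je)) =
  record { p = p ; p≤ = p≤ ; p≢c0 = p≢c0 ; β = entry ∘ base ; x = entry ins
         ; positions = insertedAt-from (skip-insertedAt p) positions-increasing
         ; values = insertedAt-from (patternValue-insertedAt c0) values-increasing } ,
  trans (π-entry (base c0) c0<L ja (trans lookup-ja (cong suc (sym (skip-self c0))))) πιja≡ua ,
  trans (π-entry ins tt je lookup-je) (cong π ιje≡e)
  where
  L : ℕ
  L = c0 + suc b
  c0<L : c0 < L
  c0<L = m<m+n c0 z<s
  entry : Role → Fin n
  entry r = entryAt ι e (slot p r)
  relabel : ∀ (h : Fin n → ℕ) r → label (h ∘ entry ∘ base) (h (entry ins)) r ≡ h (entry r)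
  relabel h (base u) = refl
  relabel h ins      = refl
  index-of-role : ∀ r → Valid L r → Σ (Fin (length ρ)) λ k → toℕ k ≡ slot p r × entry r ≡ ι k
  index-of-role r r-valid = entryAt-< ι e (subst (slot p r <_) (sym (length-insertC c0 (suc b) p p≤))
                                    (s≤s (slot-bound p r p≤ r-valid)))
  lookup-index : ∀ {r k} → Valid L r → toℕ k ≡ slot p r → lookup ρ k ≡ patternValue c0 r
  lookup-index {r} {k} r-valid toℕk≡ =
    trans (lookup≡nth ρ k) (trans (cong (nth ρ) toℕk≡) (nth-insertC c0 (suc b) p r p≤ r-valid))
  positions-increasing : ∀ {r s} → Valid L r → Valid L s → slot p r < slot p s →
    label (toℕ ∘ entry ∘ base) (toℕ (entry ins)) r < label (toℕ ∘ entry ∘ base) (toℕ (entry ins)) s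
  positions-increasing {r} {s} r-valid s-valid lt with index-of-role r r-valid | index-of-role s s-valid
  ... | j , toℕj≡ , entry-r | k , toℕk≡ , entry-s
    rewrite relabel toℕ r | relabel toℕ s | entry-r | entry-s =
    ι-increasing j k (subst₂ _<_ (sym toℕj≡) (sym toℕk≡) lt)
  values-increasing : ∀ {r s} → Valid L r → Valid L s → patternValue c0 r < patternValue c0 s →
    label (π ∘ entry ∘ base) (π (entry ins)) r < label (π ∘ entry ∘ base) (π (entry ins)) s
  values-increasing {r} {s} r-valid s-valid lt with index-of-role r r-valid | index-of-role s s-valid
  ... | j , toℕj≡ , entry-r | k , toℕk≡ , entry-s
    rewrite relabel π r | relabel π s | entry-r | entry-s =
    proj₂ (iso j k)
      (subst₂ _<_ (sym (lookup-index r-valid toℕj≡)) (sym (lookup-index s-valid toℕk≡)) lt)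
  π-entry : ∀ r → Valid L r → ∀ j → lookup ρ j ≡ patternValue c0 r → π (entry r) ≡ π (ι j)
  π-entry r r-valid j lookup-j with index-of-role r r-valid
  ... | k , toℕk≡ , entry-r rewrite entry-r =
    orderIso-≡ (π ∘ ι) (lookup ρ) iso k j (trans (lookup-index r-valid toℕk≡) (sym lookup-j))

Sval : ℕ → ℕ → ℕ → ℕ
Sval ua ua1 v = if (ua1 ≤ᵇ v) ∧ (v <ᵇ ua) then suc v else (if v ≡ᵇ ua then ua1 else v)

data SvalView (ua ua1 v : ℕ) : ℕ → Set where
  shifted : ua1 ≤ v → v < ua → SvalView ua ua1 v (suc v)
  moved   : v ≡ ua → SvalView ua ua1 v ua1
  low     : v < ua1 → SvalView ua ua1 v v
  high    : ua < v → SvalView ua ua1 v v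

svalView : ∀ {ua ua1} → ua1 < ua → ∀ v → SvalView ua ua1 v (Sval ua ua1 v)
svalView {ua} {ua1} ua1<ua v
  with ua1 ≤ᵇ v | ≤ᵇ-reflects-≤ ua1 v | v <ᵇ ua | <ᵇ-reflects-< v ua
     | v ≡ᵇ ua | fromEquivalence (≡ᵇ⇒≡ v ua) (≡⇒≡ᵇ v ua)
... | true  | ofʸ ua1≤v | true  | ofʸ v<ua | _     | _        = shifted ua1≤v v<ua
... | true  | ofʸ _     | false | _        | true  | ofʸ v≡ua = moved v≡ua
... | true  | ofʸ _     | false | ofⁿ v≮ua | false | ofⁿ v≢ua = high (≤∧≢⇒< (≮⇒≥ v≮ua) (v≢ua ∘ sym))
... | false | ofⁿ ua1≰v | _     | _        | true  | ofʸ refl = ⊥-elim (ua1≰v (<⇒≤ ua1<ua))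
... | false | ofⁿ ua1≰v | _     | _        | false | _        = low (≰⇒> ua1≰v)

orderIso-∘ : ∀ {m} (P : ℕ → Set) (g : ℕ → ℕ) → (∀ {u v} → P u → P v → u < v → g u < g v) →
  (s : Fin m → ℕ) → (∀ k → P (s k)) → OrderIso s (g ∘ s)
orderIso-∘ P g g-increasing s Ps j k = g-increasing (Ps j) (Ps k) , reflect
  where
  reflect : g (s j) < g (s k) → s j < s k
  reflect lt with <-cmp (s j) (s k)
  ... | tri< sj<sk _ _ = sj<sk
  ... | tri≈ _ sj≡sk _ = ⊥-elim (<-irrefl (cong g sj≡sk) lt)
  ... | tri> _ _ sk<sj = ⊥-elim (<-asym lt (g-increasing (Ps k) (Ps j) sk<sj))

module _ {ua ua1} (ua1<ua : ua1 < ua) where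

  Sval-increasing-≢ua : ∀ {u v} → u ≢ ua → v ≢ ua → u < v → Sval ua ua1 u < Sval ua ua1 v
  Sval-increasing-≢ua {u} {v} u≢ua v≢ua u<v = compare (svalView ua1<ua u) (svalView ua1<ua v)
    where
    compare : ∀ {Su Sv} → SvalView ua ua1 u Su → SvalView ua ua1 v Sv → Su < Sv
    compare (moved u≡ua) _ = ⊥-elim (u≢ua u≡ua)
    compare _ (moved v≡ua) = ⊥-elim (v≢ua v≡ua)
    compare (shifted _ _) (shifted _ _) = s≤s u<v
    compare (shifted ua1≤u _) (low v<ua1) = ⊥-elim (<⇒≱ (<-trans u<v v<ua1) ua1≤u)
    compare (shifted _ u<ua) (high ua<v) = ≤-<-trans u<ua ua<v
    compare (low _) (shifted _ _) = m<n⇒m<1+n u<v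
    compare (low _) (low _) = u<v
    compare (low _) (high _) = u<v
    compare (high ua<u) (shifted _ v<ua) = ⊥-elim (<-asym (<-trans ua<u u<v) v<ua)
    compare (high ua<u) (low v<ua1) = ⊥-elim (<-asym (<-trans ua1<ua (<-trans ua<u u<v)) v<ua1)
    compare (high _) (high _) = u<v

  Unshifted : ℕ → Set
  Unshifted v = ¬ (ua1 ≤ v × v < ua)

  Sval-increasing-unshifted : ∀ {u v} → Unshifted u → Unshifted v → u < v → Sval ua ua1 u < Sval ua ua1 v
  Sval-increasing-unshifted {u} {v} u-out v-out u<v = compare (svalView ua1<ua u) (svalView ua1<ua v)
    where
    compare : ∀ {Su Sv} → SvalView ua ua1 u Su → SvalView ua ua1 v Sv → Su < Sv
    compare (shifted ua1≤u u<ua) _ = ⊥-elim (u-out (ua1≤u , u<ua))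
    compare _ (shifted ua1≤v v<ua) = ⊥-elim (v-out (ua1≤v , v<ua))
    compare (moved refl) (moved refl) = ⊥-elim (<-irrefl refl u<v)
    compare (moved refl) (low v<ua1) = ⊥-elim (<-asym (<-trans ua1<ua u<v) v<ua1)
    compare (moved refl) (high _) = <-trans ua1<ua u<v
    compare (low u<ua1) (moved _) = u<ua1
    compare (low _) (low _) = u<v
    compare (low _) (high _) = u<v
    compare (high ua<u) (moved refl) = ⊥-elim (<-asym ua<u u<v)
    compare (high ua<u) (low v<ua1) = ⊥-elim (<-asym (<-trans ua1<ua (<-trans ua<u u<v)) v<ua1)
    compare (high _) (high _) = u<v

module UnderlinedValues {n} (π : Fin n → ℕ) (π-injective : ∀ i j → π i ≡ π j → i ≡ j)
  (c0 b ua ua1 : ℕ)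
  (UA : IsUnderA (suc (suc c0)) b π ua) (UA1 : IsUnderA1 (suc (suc c0)) b π ua ua1) where

  private
    L : ℕ
    L = c0 + suc b
    c0<L : c0 < L
    c0<L = m<m+n c0 z<s
    e1 : Fin n
    e1 = proj₁ (proj₁ UA1)
    e1-assoc : AssocA1 (suc (suc c0)) b π ua e1
    e1-assoc = proj₁ (proj₂ (proj₁ UA1))
    πe1≡ua1 : π e1 ≡ ua1
    πe1≡ua1 = proj₂ (proj₂ (proj₁ UA1))
    witness : Σ (PiOccurrence π c0 b) λ O →
      π (PiOccurrence.β O c0) ≡ ua × π (PiOccurrence.x O) ≡ π e1
    witness = PiOccurrence-from-assocA1 {π = π} e1-assoc
    open PiOccurrence (proj₁ witness)
    πβc0≡ua : π (β c0) ≡ ua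
    πβc0≡ua = proj₁ (proj₂ witness)
    πx≡ua1 : π x ≡ ua1
    πx≡ua1 = trans (proj₂ (proj₂ witness)) πe1≡ua1

  ua1<ua : ua1 < ua
  ua1<ua = subst₂ _<_ πx≡ua1 πβc0≡ua (above values c0<L ≤-refl)

  assocA1-between : ∀ y → ua1 < π y → π y < ua → AssocA1 (suc (suc c0)) b π ua y
  assocA1-between y ua1<πy πy<ua = by-position (insertion-point (increasing positions) avoids)
    where
    values-y : InsertedAt L c0 (π ∘ β) (π y)
    values-y = insertedAt-between c0<L (subst (_< π y) (sym πx≡ua1) ua1<πy)
                 (subst (π y <_) (sym πβc0≡ua) πy<ua) values

    avoids : ∀ {k} → k < L → toℕ (β k) ≢ toℕ y
    avoids k<L βk≡y = insertedAt-≢ values-y k<L (cong π (toℕ-injective βk≡y))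

    y-as-x : ∀ {q} → q ≤ L → q ≢ c0 → InsertedAt L q (toℕ ∘ β) (toℕ y) → PiOccurrence π c0 b
    y-as-x {q} q≤L q≢c0 positions-y = record
      { p = q ; p≤ = q≤L ; p≢c0 = q≢c0 ; β = β ; x = y ; positions = positions-y ; values = values-y }

    y-as-βc0 : InsertedAt L c0 (toℕ ∘ β) (toℕ y) → PiOccurrence π c0 b
    y-as-βc0 positions-y = record
      { p = p ; p≤ = p≤ ; p≢c0 = p≢c0 ; β = replace β c0 y ; x = x
      ; positions = insertedAt-replace positions positions-y
          (proj₁ (insertedAt-compare c0<L p≢c0 positions positions-y))
          (proj₂ (insertedAt-compare c0<L p≢c0 positions positions-y))
          (cong toℕ (replace-same β c0 y)) (cong toℕ ∘ replace-other β c0 y)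
      ; values = insertedAt-replace values values-y (λ c0<c0 → ⊥-elim (<-irrefl refl c0<c0))
          (λ _ → subst (_< π y) (sym πx≡ua1) ua1<πy)
          (cong π (replace-same β c0 y)) (cong π ∘ replace-other β c0 y)
      }

    by-position : Σ ℕ (λ q → q ≤ L × InsertedAt L q (toℕ ∘ β) (toℕ y)) →
      AssocA1 (suc (suc c0)) b π ua y
    by-position (q , q≤L , positions-y) with q ≟ c0
    ... | no q≢c0 =
      subst (λ v → AssocA1 _ b π v y) πβc0≡ua (PiOccurrence-assocA1 (y-as-x q≤L q≢c0 positions-y))
    ... | yes refl = ⊥-elim (<⇒≱ πy<ua (proj₂ UA y
          (subst (PlaysA _ b π) (replace-same β c0 y) (PiOccurrence-playsA (y-as-βc0 positions-y)))))

  assocA1-range : ∀ y → ua1 ≤ π y → π y < ua → AssocA1 (suc (suc c0)) b π ua y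
  assocA1-range y ua1≤πy πy<ua with m≤n⇒m<n∨m≡n ua1≤πy
  ... | inj₁ ua1<πy = assocA1-between y ua1<πy πy<ua
  ... | inj₂ ua1≡πy with π-injective e1 y (trans πe1≡ua1 ua1≡πy)
  ...   | refl = e1-assoc

corollary2p5 : (a b : ℕ) → 2 ≤ a → (n : ℕ) → (π : Fin n → ℕ) → IsPerm n π →
    (ua ua1 : ℕ) → IsUnderA a b π ua → IsUnderA1 a b π ua ua1 →
    (m : ℕ) → (ι : Fin m → Fin n) → StrictInc ι →
    ¬ OrderIso (λ k → π (ι k)) (λ k → Smap ua ua1 π (ι k)) →
    (Σ (Fin m) λ k → π (ι k) ≡ ua) × (Σ (Fin m) λ k → AssocA1 a b π ua (ι k))
corollary2p5 (suc (suc c0)) b (s≤s (s≤s _)) n π (_ , π-injective) ua ua1 UA UA1 m ι _ not-iso =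
  contains-ua , contains-assoc
  where
  open UnderlinedValues π π-injective c0 b ua ua1 UA UA1

  contains-ua : Σ (Fin m) λ k → π (ι k) ≡ ua
  contains-ua with any? (λ k → π (ι k) ≟ ua)
  ... | yes found = found
  ... | no none = ⊥-elim (not-iso (orderIso-∘ (_≢ ua) (Sval ua ua1) (Sval-increasing-≢ua ua1<ua)
                    (π ∘ ι) (λ k πιk≡ua → none (k , πιk≡ua))))

  contains-assoc : Σ (Fin m) λ k → AssocA1 (suc (suc c0)) b π ua (ι k)
  contains-assoc with any? (λ k → (ua1 ≤? π (ι k)) ×-dec (π (ι k) <? ua))
  ... | yes (k , ua1≤πιk , πιk<ua) = k , assocA1-range (ι k) ua1≤πιk πιk<ua
  ... | no none = ⊥-elim (not-iso (orderIso-∘ (Unshifted ua1<ua) (Sval ua ua1) (Sval-increasing-unshifted ua1<ua)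
                    (π ∘ ι) (λ k shifted → none (k , shifted))))
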